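{- Let $\lambda$ be a nonzero real number, $r\ge0$ an integer, and $m$ a positive odd integer. Then for every integer $n\ge0$, $$A_{n,\lambda}^{(r)}(x)= m^{n-r}\sum_{l=0}^{m-1}(-1)^{l}A_{n,\lambda/m}^{(r)}\Big(\frac{l+x}{m}\Big).$$
   Context: For nonzero real $\mu$, the generalized falling factorials are $(x)_{0,\mu}=1$, $(x)_{n,\mu}=x(x-\mu)\cdots(x-(n-1)\mu)$ for $n\ge1$; the degenerate exponential is $e_\mu^x(t)=(1+\mu t)^{x/\mu}=\sum_{n\ge0}(x)_{n,\mu}\frac{t^n}{n!}$ and $e_\mu(t)=e_\mu^1(t)$. For an integer $r\ge0$, the generalized degenerate Euler-Genocchi polynomials $A_{n,\mu}^{(r)}(x)$ are defined by $\frac{2t^{r}}{e_{\mu}(t)+1}e_{\mu}^{x}(t)=\sum_{n=0}^{\infty}A_{n,\mu}^{(r)}(x)\frac{t^{n}}{n!}$. -}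

module Defs where

open import Level using (Level)
open import Data.Bool using (if_then_else_)
open import Data.Nat as ℕ using (ℕ; zero; suc; _≤ᵇ_; _≡ᵇ_; _!)
open import Data.Nat.Combinatorics using (_C_)
open import Algebra.Bundles using (CommutativeRing)

module Ops {c ℓ : Level} (R : CommutativeRing c ℓ) where
  open CommutativeRing R public

  ι : ℕ → Carrier
  ι zero = 0#
  ι (suc n) = 1# + ι n

  pow : Carrier → ℕ → Carrier
  pow a zero = 1#
  pow a (suc n) = a * pow a n

  sumTo : ℕ → (ℕ → Carrier) → Carrier
  sumTo zero f = 0#
  sumTo (suc n) f = sumTo n f + f n

  falling : Carrier → Carrier → ℕ → Carrier
  falling x μ zero = 1#
  falling x μ (suc n) = falling x μ n * (x - ι n * μ)

  -- formal power series, written as exponential generating functions: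
  -- the series f stands for  Σ_n f n · t^n / n!
  Series : Set c
  Series = ℕ → Carrier

  _⋆_ : Series → Series → Series
  (f ⋆ g) n = sumTo (suc n) (λ k → ι (n C k) * (f k * g (n ℕ.∸ k)))

  -- inverse of an EGF f, given an inverse cinv of its constant term f 0:
  -- g 0 = cinv,  g n = - cinv · Σ_{k=1}^{n} C(n,k) f k g (n-k)
  invTable : Carrier → Series → ℕ → Series
  invTable cinv f zero = λ _ → cinv
  invTable cinv f (suc n) = λ i → if i ≤ᵇ n then invTable cinv f n i
    else - (cinv * sumTo (suc n) (λ k → ι (suc n C suc k) * (f (suc k) * invTable cinv f n (n ℕ.∸ k))))

  egfInv : Carrier → Series → Series
  egfInv cinv f n = invTable cinv f n n

  -- degenerate exponential e_μ^x(t) = Σ (x)_{n,μ} t^n / n!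
  degExp : Carrier → Carrier → Series
  degExp μ x n = falling x μ n

  degExpPlusOne : Carrier → Series
  degExpPlusOne μ n = if n ≡ᵇ 0 then degExp μ 1# n + 1# else degExp μ 1# n

  twoTPow : ℕ → Series
  twoTPow r n = if n ≡ᵇ r then (1# + 1#) * ι (r !) else 0#

  -- generalized degenerate Euler-Genocchi polynomial A^{(r)}_{n,μ}(x),
  -- the n-th EGF coefficient of 2 t^r / (e_μ(t) + 1) · e_μ^x(t).
  -- half is the inverse of 2 (= the constant term of e_μ(t) + 1).
  A : (half : Carrier) → (n : ℕ) → (μ : Carrier) → (r : ℕ) → (x : Carrier) → Carrier
  A half n μ r x = ((twoTPow r ⋆ egfInv half (degExpPlusOne μ)) ⋆ degExp μ x) n

  -- m^{n-r} with integer exponent, given an inverse minv of m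
  mPowDiff : (m : ℕ) → (minv : Carrier) → (n r : ℕ) → Carrier
  mPowDiff m minv n r = if r ≤ᵇ n then pow (ι m) (n ℕ.∸ r) else pow minv (r ℕ.∸ n)

-- Everything is an identity between exponential generating functions over a commutative ring.
-- Put E_μ(t) = e_μ(t) + 1, so that A^{(r)}_{n,μ}(x) is the coefficient of t^n/n! in 2t^r E_μ(t)⁻¹ e_μ^x(t).
-- Dilating t ↦ mt multiplies the n-th coefficient by m^n, turns e_{μ/m}^{y/m}(t) into e_μ^y(t),
-- and so turns E_{μ/m}(t) into e_μ^m(t) + 1 = E_μ(t) · Σ_{l<m} (-1)^l e_μ^l(t), because m is odd.
-- Hence E_{μ/m}(mt)⁻¹ · Σ_{l<m} (-1)^l e_μ^l(t) = E_μ(t)⁻¹, and the dilation of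
-- Σ_{l<m} (-1)^l A^{(r)}_{·,μ/m}((l+x)/m) is m^r A^{(r)}_{·,μ}(x); comparing coefficients of t^n
-- gives m^n Σ_l (-1)^l A^{(r)}_{n,μ/m}((l+x)/m) = m^r A^{(r)}_{n,μ}(x).
module Submission where

open import Defs
open import Level using (Level)
open import Algebra.Bundles using (CommutativeRing)
open import Algebra.Solver.Ring.AlmostCommutativeRing using (fromCommutativeRing; _-Raw-AlmostCommutative⟶_)
open import Data.Bool using (true; false)
open import Data.Integer as ℤ using (ℤ; +_; -[1+_]; +0; +[1+_]; _⊖_)
import Data.Integer.Properties as ℤ
open import Data.Maybe using (Maybe; just; nothing)
open import Data.Nat as ℕ using (ℕ; zero; suc; _≤ᵇ_; _≡ᵇ_)
open import Data.Nat.Combinatorics using (_C_; nCk+nC[k+1]≡[n+1]C[k+1]; k>n⇒nCk≡0)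
import Data.Nat.Properties as ℕ
open import Data.Sum using (inj₁; inj₂)
open import Relation.Binary.Bundles using (Setoid)
open import Relation.Binary.PropositionalEquality using (_≡_)
import Relation.Binary.PropositionalEquality as ≡
import Relation.Binary.Reasoning.Setoid as SetoidReasoning
open import Relation.Nullary using (¬_; yes; no; contradiction)
open import Relation.Nullary.Reflects using (ofʸ; ofⁿ; fromEquivalence)

-- Integers are interpreted through the type-checking-optimised multiplication _×_, so that the
-- constants con (+ 0) and con (+ 1) of a solved equation evaluate to 0# and 1# on the nose.
module IntegerCoefficientRingSolver {c ℓ : Level} (R : CommutativeRing c ℓ) where
  open CommutativeRing R
  open import Algebra.Properties.Ring ring using (-‿distribˡ-*; -‿distribʳ-*; -0#≈0#; -‿involutive; -‿+-comm)
  open import Algebra.Properties.CommutativeSemigroup +-commutativeSemigroup using (interchange)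
  open import Algebra.Properties.Monoid.Mult.TCOptimised +-monoid using (_×_; 1+×; ×-homo-+)
  open import Algebra.Properties.Semiring.Mult.TCOptimised semiring using (×1-homo-*)
  open SetoidReasoning setoid

  ⟦_⟧ : ℤ → Carrier
  ⟦ + n ⟧ = n × 1#
  ⟦ -[1+ n ] ⟧ = - (suc n × 1#)

  -‿homo : ∀ i → ⟦ ℤ.- i ⟧ ≈ - ⟦ i ⟧
  -‿homo +0 = sym -0#≈0#
  -‿homo +[1+ n ] = refl
  -‿homo -[1+ n ] = sym (-‿involutive _)

  ⊖-homo : ∀ m n → ⟦ m ⊖ n ⟧ ≈ m × 1# - n × 1#
  ⊖-homo zero zero = sym (trans (+-identityˡ _) -0#≈0#)
  ⊖-homo zero (suc n) = sym (+-identityˡ _)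
  ⊖-homo (suc m) zero = sym (trans (+-congˡ -0#≈0#) (+-identityʳ _))
  ⊖-homo (suc m) (suc n) rewrite ℤ.[1+m]⊖[1+n]≡m⊖n m n = begin
    ⟦ m ⊖ n ⟧                        ≈⟨ ⊖-homo m n ⟩
    m × 1# - n × 1#                  ≈⟨ +-identityˡ _ ⟨
    0# + (m × 1# - n × 1#)           ≈⟨ +-congʳ (-‿inverseʳ 1#) ⟨
    (1# - 1#) + (m × 1# - n × 1#)    ≈⟨ interchange _ _ _ _ ⟩
    (1# + m × 1#) + (- 1# - n × 1#)  ≈⟨ +-congˡ (-‿+-comm _ _) ⟩
    (1# + m × 1#) - (1# + n × 1#)    ≈⟨ +-cong (1+× m 1#) (-‿cong (1+× n 1#)) ⟨
    suc m × 1# - suc n × 1#          ∎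

  +-homo : ∀ i j → ⟦ i ℤ.+ j ⟧ ≈ ⟦ i ⟧ + ⟦ j ⟧
  +-homo (+ m) (+ n) = ×-homo-+ 1# m n
  +-homo (+ m) -[1+ n ] = ⊖-homo m (suc n)
  +-homo -[1+ m ] (+ n) = trans (⊖-homo n (suc m)) (+-comm _ _)
  +-homo -[1+ m ] -[1+ n ] = begin
    - (suc (suc (m ℕ.+ n)) × 1#)  ≡⟨ ≡.cong (λ k → - (suc k × 1#)) (ℕ.+-suc m n) ⟨
    - ((suc m ℕ.+ suc n) × 1#)    ≈⟨ -‿cong (×-homo-+ 1# (suc m) (suc n)) ⟩
    - (suc m × 1# + suc n × 1#)   ≈⟨ -‿+-comm _ _ ⟨
    - (suc m × 1#) - suc n × 1#   ∎

  *-homo-+ : ∀ i n → ⟦ i ℤ.* + n ⟧ ≈ ⟦ i ⟧ * n × 1#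
  *-homo-+ (+ m) n = trans (reflexive (≡.cong ⟦_⟧ (≡.sym (ℤ.pos-* m n)))) (×1-homo-* m n)
  *-homo-+ -[1+ m ] n = begin
    ⟦ -[1+ m ] ℤ.* + n ⟧       ≡⟨ ≡.cong ⟦_⟧ (ℤ.neg-distribˡ-* (+ suc m) (+ n)) ⟨
    ⟦ ℤ.- (+ suc m ℤ.* + n) ⟧  ≈⟨ -‿homo (+ suc m ℤ.* + n) ⟩
    - ⟦ + suc m ℤ.* + n ⟧      ≈⟨ -‿cong (*-homo-+ (+ suc m) n) ⟩
    - (suc m × 1# * n × 1#)    ≈⟨ -‿distribˡ-* _ _ ⟩
    - (suc m × 1#) * n × 1#    ∎

  *-homo : ∀ i j → ⟦ i ℤ.* j ⟧ ≈ ⟦ i ⟧ * ⟦ j ⟧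
  *-homo i (+ n) = *-homo-+ i n
  *-homo i -[1+ n ] = begin
    ⟦ i ℤ.* -[1+ n ] ⟧         ≡⟨ ≡.cong ⟦_⟧ (ℤ.neg-distribʳ-* i (+ suc n)) ⟨
    ⟦ ℤ.- (i ℤ.* + suc n) ⟧    ≈⟨ -‿homo (i ℤ.* + suc n) ⟩
    - ⟦ i ℤ.* + suc n ⟧        ≈⟨ -‿cong (*-homo-+ i (suc n)) ⟩
    - (⟦ i ⟧ * suc n × 1#)     ≈⟨ -‿distribʳ-* _ _ ⟩
    ⟦ i ⟧ * - (suc n × 1#)     ∎

  ⟦⟧-morphism : ℤ.+-*-rawRing -Raw-AlmostCommutative⟶ fromCommutativeRing R
  ⟦⟧-morphism = record
    { ⟦_⟧ = ⟦_⟧ ; +-homo = +-homo ; *-homo = *-homo ; -‿homo = -‿homo ; 0-homo = refl ; 1-homo = refl }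

  ⟦⟧-≟ : ∀ i j → Maybe (⟦ i ⟧ ≈ ⟦ j ⟧)
  ⟦⟧-≟ i j with i ℤ.≟ j
  ... | yes i≡j = just (reflexive (≡.cong ⟦_⟧ i≡j))
  ... | no _ = nothing

  open import Algebra.Solver.Ring ℤ.+-*-rawRing (fromCommutativeRing R) ⟦⟧-morphism ⟦⟧-≟ public
    using (solve; _:=_; _:+_; _:*_; _:-_; :-_; con)

module _ {c ℓ : Level} (R : CommutativeRing c ℓ) where
  open Ops R
  open IntegerCoefficientRingSolver R
  open import Algebra.Properties.CommutativeSemigroup +-commutativeSemigroup
    using () renaming (interchange to +-interchange; x∙yz≈y∙xz to x+[y+z]≈y+[x+z])
  open import Algebra.Properties.CommutativeSemigroup *-commutativeSemigroup
    using () renaming (interchange to *-interchange; x∙yz≈y∙xz to x*[y*z]≈y*[x*z])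
  module ≈-Reasoning = SetoidReasoning setoid

  sumTo-cong< : ∀ n {f g : ℕ → Carrier} → (∀ k → k ℕ.< n → f k ≈ g k) → sumTo n f ≈ sumTo n g
  sumTo-cong< zero f≈g = refl
  sumTo-cong< (suc n) f≈g =
    +-cong (sumTo-cong< n (λ k k<n → f≈g k (ℕ.m<n⇒m<1+n k<n))) (f≈g n (ℕ.n<1+n n))

  sumTo-cong : ∀ n {f g : ℕ → Carrier} → (∀ k → f k ≈ g k) → sumTo n f ≈ sumTo n g
  sumTo-cong n f≈g = sumTo-cong< n (λ k _ → f≈g k)

  sumTo-+ : ∀ n (f g : ℕ → Carrier) → sumTo n (λ k → f k + g k) ≈ sumTo n f + sumTo n g
  sumTo-+ zero f g = sym (+-identityˡ 0#)
  sumTo-+ (suc n) f g = trans (+-congʳ (sumTo-+ n f g)) (+-interchange _ _ _ _)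

  *-distribˡ-sumTo : ∀ n a (f : ℕ → Carrier) → a * sumTo n f ≈ sumTo n (λ k → a * f k)
  *-distribˡ-sumTo zero a f = zeroʳ a
  *-distribˡ-sumTo (suc n) a f = trans (distribˡ _ _ _) (+-congʳ (*-distribˡ-sumTo n a f))

  sumTo-zero : ∀ n {f : ℕ → Carrier} → (∀ k → f k ≈ 0#) → sumTo n f ≈ 0#
  sumTo-zero zero f≈0 = refl
  sumTo-zero (suc n) f≈0 = trans (+-cong (sumTo-zero n f≈0) (f≈0 n)) (+-identityʳ 0#)

  sumTo-suc : ∀ n (f : ℕ → Carrier) → sumTo (suc n) f ≈ f 0 + sumTo n (λ k → f (suc k))
  sumTo-suc zero f = trans (+-identityˡ _) (sym (+-identityʳ _))
  sumTo-suc (suc n) f = trans (+-congʳ (sumTo-suc n f)) (+-assoc _ _ _)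

  alternatingSum-telescopes : ∀ j (a : ℕ → Carrier) →
    sumTo j (λ l → pow (- 1#) l * (a (suc l) + a l)) ≈ a 0 - pow (- 1#) j * a j
  alternatingSum-telescopes zero a = solve 1 (λ a → con +0 := a :- con (+ 1) :* a) refl (a 0)
  alternatingSum-telescopes (suc j) a = trans (+-congʳ (alternatingSum-telescopes j a))
    (solve 4 (λ a₀ s b b′ → (a₀ :- s :* b) :+ s :* (b′ :+ b) := a₀ :- (:- con (+ 1) :* s) :* b′)
      refl (a 0) (pow (- 1#) j) (a j) (a (suc j)))

  pow-+ : ∀ a m n → pow a (m ℕ.+ n) ≈ pow a m * pow a n
  pow-+ a zero n = sym (*-identityˡ _)
  pow-+ a (suc m) n = trans (*-congˡ (pow-+ a m n)) (sym (*-assoc _ _ _))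

  pow-+-∸ : ∀ a {i j} → i ℕ.≤ j → pow a j ≈ pow a i * pow a (j ℕ.∸ i)
  pow-+-∸ a {i} {j} i≤j =
    trans (reflexive (≡.cong (pow a) (≡.sym (ℕ.m+[n∸m]≡n i≤j)))) (pow-+ a i (j ℕ.∸ i))

  pow-inverse : ∀ {a b} → a * b ≈ 1# → ∀ n → pow a n * pow b n ≈ 1#
  pow-inverse ab≈1 zero = *-identityˡ 1#
  pow-inverse ab≈1 (suc n) =
    trans (*-interchange _ _ _ _) (trans (*-cong ab≈1 (pow-inverse ab≈1 n)) (*-identityˡ 1#))

  pow-odd : ∀ k → pow (- 1#) (suc (2 ℕ.* k)) ≈ - 1#
  pow-odd k rewrite ℕ.+-identityʳ k =
    trans (*-congˡ (trans (pow-+ (- 1#) k k) (pow-inverse -1*-1≈1 k))) (*-identityʳ _)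
    where
    -1*-1≈1 : - 1# * - 1# ≈ 1#
    -1*-1≈1 = solve 0 (:- con (+ 1) :* :- con (+ 1) := con (+ 1)) refl

  invertible-cancelˡ : ∀ {u v a b} → u * v ≈ 1# → u * a ≈ u * b → a ≈ b
  invertible-cancelˡ {u} {v} {a} {b} uv≈1 ua≈ub = begin
    a            ≈⟨ trans (*-congʳ (trans (*-comm v u) uv≈1)) (*-identityˡ a) ⟨
    (v * u) * a  ≈⟨ trans (*-assoc v u a) (*-congˡ ua≈ub) ⟩
    v * (u * b)  ≈⟨ *-assoc v u b ⟨
    (v * u) * b  ≈⟨ trans (*-congʳ (trans (*-comm v u) uv≈1)) (*-identityˡ b) ⟩
    b            ∎
    where open ≈-Reasoning

  pow-cancelˡ : ∀ {u v} → u * v ≈ 1# → ∀ j {a b} → pow u j * a ≈ pow u j * b → a ≈ b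
  pow-cancelˡ uv≈1 j = invertible-cancelˡ (pow-inverse uv≈1 j)

  mPowDiff-cancel : ∀ {m m⁻¹} → ι m * m⁻¹ ≈ 1# → ∀ n r {s t} →
    pow (ι m) n * s ≈ pow (ι m) r * t → t ≈ mPowDiff m m⁻¹ n r * s
  mPowDiff-cancel {m} {m⁻¹} mm⁻¹≈1 n r {s} {t} mⁿs≈mʳt with r ≤ᵇ n | ℕ.≤ᵇ-reflects-≤ r n
  ... | true | ofʸ r≤n = sym (pow-cancelˡ mm⁻¹≈1 r (begin
    pow (ι m) r * (pow (ι m) (n ℕ.∸ r) * s)  ≈⟨ *-assoc _ _ _ ⟨
    pow (ι m) r * pow (ι m) (n ℕ.∸ r) * s    ≈⟨ *-congʳ (pow-+-∸ (ι m) r≤n) ⟨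
    pow (ι m) n * s                          ≈⟨ mⁿs≈mʳt ⟩
    pow (ι m) r * t                          ∎))
    where open ≈-Reasoning
  ... | false | ofⁿ r≰n = pow-cancelˡ mm⁻¹≈1 d (begin
    pow (ι m) d * t                ≈⟨ s≈mᵈt ⟨
    s                              ≈⟨ trans (*-congʳ (pow-inverse mm⁻¹≈1 d)) (*-identityˡ s) ⟨
    pow (ι m) d * pow m⁻¹ d * s    ≈⟨ *-assoc _ _ _ ⟩
    pow (ι m) d * (pow m⁻¹ d * s)  ∎)
    where
    open ≈-Reasoning
    d : ℕ
    d = r ℕ.∸ n
    s≈mᵈt : s ≈ pow (ι m) d * t
    s≈mᵈt = pow-cancelˡ mm⁻¹≈1 n (begin
      pow (ι m) n * s                  ≈⟨ mⁿs≈mʳt ⟩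
      pow (ι m) r * t                  ≈⟨ *-congʳ (pow-+-∸ (ι m) (ℕ.≰⇒≥ r≰n)) ⟩
      pow (ι m) n * pow (ι m) d * t    ≈⟨ *-assoc _ _ _ ⟩
      pow (ι m) n * (pow (ι m) d * t)  ∎)

  infix 4 _≋_
  _≋_ : Series → Series → Set ℓ
  f ≋ g = ∀ n → f n ≈ g n

  ≋-setoid : Setoid c ℓ
  ≋-setoid = record
    { Carrier = Series
    ; _≈_ = _≋_
    ; isEquivalence = record
      { refl = λ _ → refl
      ; sym = λ f≋g n → sym (f≋g n)
      ; trans = λ f≋g g≋h n → trans (f≋g n) (g≋h n)
      }
    }

  open Setoid ≋-setoid using () renaming (refl to ≋-refl; sym to ≋-sym; trans to ≋-trans)
  module ≋-Reasoning = SetoidReasoning ≋-setoid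

  𝟙 : Series
  𝟙 zero = 1#
  𝟙 (suc n) = 0#

  infixl 6 _⊕_
  _⊕_ : Series → Series → Series
  (f ⊕ g) n = f n + g n

  infixr 7 _·_
  _·_ : Carrier → Series → Series
  (a · f) n = a * f n

  ∂ : Series → Series
  ∂ f n = f (suc n)

  ·-congˡ : ∀ a {f g} → f ≋ g → a · f ≋ a · g
  ·-congˡ a f≋g n = *-congˡ (f≋g n)

  ⋆-cong : ∀ {f f′ g g′} → f ≋ f′ → g ≋ g′ → f ⋆ g ≋ f′ ⋆ g′
  ⋆-cong f≋f′ g≋g′ n = sumTo-cong (suc n) (λ k → *-congˡ (*-cong (f≋f′ k) (g≋g′ (n ℕ.∸ k))))

  ⋆-congˡ : ∀ f {g g′} → g ≋ g′ → f ⋆ g ≋ f ⋆ g′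
  ⋆-congˡ f = ⋆-cong {f = f} ≋-refl

  ⋆-congʳ : ∀ g {f f′} → f ≋ f′ → f ⋆ g ≋ f′ ⋆ g
  ⋆-congʳ g f≋f′ = ⋆-cong {g = g} f≋f′ ≋-refl

  ⋆-at-0 : ∀ f g → (f ⋆ g) 0 ≈ f 0 * g 0
  ⋆-at-0 f g = trans (+-identityˡ _) (trans (*-congʳ (+-identityʳ 1#)) (*-identityˡ _))

  ⋆-distribʳ-⊕ : ∀ f g h → (f ⊕ g) ⋆ h ≋ f ⋆ h ⊕ g ⋆ h
  ⋆-distribʳ-⊕ f g h n = trans
    (sumTo-cong (suc n) (λ k → trans (*-congˡ (distribʳ _ _ _)) (distribˡ _ _ _)))
    (sumTo-+ (suc n) _ _)

  ⋆-distribˡ-⊕ : ∀ f g h → f ⋆ (g ⊕ h) ≋ f ⋆ g ⊕ f ⋆ h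
  ⋆-distribˡ-⊕ f g h n = trans
    (sumTo-cong (suc n) (λ k → trans (*-congˡ (distribˡ _ _ _)) (distribˡ _ _ _)))
    (sumTo-+ (suc n) _ _)

  ·-⋆-assoc : ∀ a f g → (a · f) ⋆ g ≋ a · (f ⋆ g)
  ·-⋆-assoc a f g n = trans
    (sumTo-cong (suc n) (λ k → trans (*-congˡ (*-assoc _ _ _)) (x*[y*z]≈y*[x*z] _ _ _)))
    (sym (*-distribˡ-sumTo (suc n) a _))

  ι-+ : ∀ m n → ι (m ℕ.+ n) ≈ ι m + ι n
  ι-+ zero n = sym (+-identityˡ _)
  ι-+ (suc m) n = trans (+-congˡ (ι-+ m n)) (sym (+-assoc _ _ _))

  ι-pascal : ∀ n k → ι (suc n C suc k) ≈ ι (n C k) + ι (n C suc k)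
  ι-pascal n k = trans (reflexive (≡.cong ι (≡.sym (nCk+nC[k+1]≡[n+1]C[k+1] n k)))) (ι-+ (n C k) (n C suc k))

  ∂-⋆ : ∀ f g → ∂ (f ⋆ g) ≋ ∂ f ⋆ g ⊕ f ⋆ ∂ g
  ∂-⋆ f g n = begin
    (f ⋆ g) (suc n)
      ≈⟨ sumTo-suc (suc n) _ ⟩
    f₀g′ₙ + sumTo (suc n) (λ k → ι (suc n C suc k) * (f (suc k) * g (n ℕ.∸ k)))
      ≈⟨ +-congˡ (trans (sumTo-cong (suc n) (λ k → trans (*-congʳ (ι-pascal n k)) (distribʳ _ _ _)))
                        (sumTo-+ (suc n) _ _)) ⟩
    f₀g′ₙ + ((∂ f ⋆ g) n + sumTo (suc n) (λ k → ι (n C suc k) * (f (suc k) * g (n ℕ.∸ k))))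
      ≈⟨ x+[y+z]≈y+[x+z] _ _ _ ⟩
    (∂ f ⋆ g) n + (f₀g′ₙ + sumTo (suc n) (λ k → ι (n C suc k) * (f (suc k) * g (n ℕ.∸ k))))
      ≈⟨ +-congˡ (+-congˡ last-term-vanishes) ⟩
    (∂ f ⋆ g) n + (f₀g′ₙ + sumTo n (λ k → ι (n C suc k) * (f (suc k) * ∂ g (n ℕ.∸ suc k))))
      ≈⟨ +-congˡ (sumTo-suc n _) ⟨
    (∂ f ⋆ g) n + (f ⋆ ∂ g) n
      ∎
    where
    open ≈-Reasoning
    f₀g′ₙ : Carrier
    f₀g′ₙ = ι 1 * (f 0 * g (suc n))
    last-term-vanishes : sumTo (suc n) (λ k → ι (n C suc k) * (f (suc k) * g (n ℕ.∸ k)))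
                       ≈ sumTo n (λ k → ι (n C suc k) * (f (suc k) * ∂ g (n ℕ.∸ suc k)))
    last-term-vanishes = trans
      (+-cong (sumTo-cong< n (λ k k<n → *-congˡ (*-congˡ (reflexive (≡.cong g (ℕ.+-∸-assoc 1 k<n))))))
              (trans (*-congʳ (reflexive (≡.cong ι (k>n⇒nCk≡0 (ℕ.n<1+n n))))) (zeroˡ _)))
      (+-identityʳ _)

  ⋆-comm : ∀ f g → f ⋆ g ≋ g ⋆ f
  ⋆-comm f g zero = trans (⋆-at-0 f g) (trans (*-comm _ _) (sym (⋆-at-0 g f)))
  ⋆-comm f g (suc n) = begin
    (f ⋆ g) (suc n)            ≈⟨ ∂-⋆ f g n ⟩
    (∂ f ⋆ g) n + (f ⋆ ∂ g) n  ≈⟨ +-cong (⋆-comm (∂ f) g n) (⋆-comm f (∂ g) n) ⟩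
    (g ⋆ ∂ f) n + (∂ g ⋆ f) n  ≈⟨ +-comm _ _ ⟩
    (∂ g ⋆ f) n + (g ⋆ ∂ f) n  ≈⟨ ∂-⋆ g f n ⟨
    (g ⋆ f) (suc n)            ∎
    where open ≈-Reasoning

  ⋆-·-comm : ∀ a f g → f ⋆ (a · g) ≋ a · (f ⋆ g)
  ⋆-·-comm a f g = ≋-trans (⋆-comm f (a · g)) (≋-trans (·-⋆-assoc a g f) (·-congˡ a (⋆-comm g f)))

  ⋆-assoc : ∀ f g h → (f ⋆ g) ⋆ h ≋ f ⋆ (g ⋆ h)
  ⋆-assoc f g h zero = begin
    ((f ⋆ g) ⋆ h) 0    ≈⟨ trans (⋆-at-0 (f ⋆ g) h) (*-congʳ (⋆-at-0 f g)) ⟩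
    (f 0 * g 0) * h 0  ≈⟨ *-assoc _ _ _ ⟩
    f 0 * (g 0 * h 0)  ≈⟨ trans (⋆-at-0 f (g ⋆ h)) (*-congˡ (⋆-at-0 g h)) ⟨
    (f ⋆ (g ⋆ h)) 0    ∎
    where open ≈-Reasoning
  ⋆-assoc f g h (suc n) = begin
    ((f ⋆ g) ⋆ h) (suc n)
      ≈⟨ ∂-⋆ (f ⋆ g) h n ⟩
    (∂ (f ⋆ g) ⋆ h) n + ((f ⋆ g) ⋆ ∂ h) n
      ≈⟨ +-congʳ (trans (⋆-congʳ h (∂-⋆ f g) n) (⋆-distribʳ-⊕ (∂ f ⋆ g) (f ⋆ ∂ g) h n)) ⟩
    (((∂ f ⋆ g) ⋆ h) n + ((f ⋆ ∂ g) ⋆ h) n) + ((f ⋆ g) ⋆ ∂ h) n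
      ≈⟨ +-cong (+-cong (⋆-assoc (∂ f) g h n) (⋆-assoc f (∂ g) h n)) (⋆-assoc f g (∂ h) n) ⟩
    ((∂ f ⋆ (g ⋆ h)) n + (f ⋆ (∂ g ⋆ h)) n) + (f ⋆ (g ⋆ ∂ h)) n
      ≈⟨ +-assoc _ _ _ ⟩
    (∂ f ⋆ (g ⋆ h)) n + ((f ⋆ (∂ g ⋆ h)) n + (f ⋆ (g ⋆ ∂ h)) n)
      ≈⟨ +-congˡ (trans (⋆-congˡ f (∂-⋆ g h) n) (⋆-distribˡ-⊕ f (∂ g ⋆ h) (g ⋆ ∂ h) n)) ⟨
    (∂ f ⋆ (g ⋆ h)) n + (f ⋆ ∂ (g ⋆ h)) n
      ≈⟨ ∂-⋆ f (g ⋆ h) n ⟨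
    (f ⋆ (g ⋆ h)) (suc n)
      ∎
    where open ≈-Reasoning

  ⋆-identityˡ : ∀ f → 𝟙 ⋆ f ≋ f
  ⋆-identityˡ f n = begin
    (𝟙 ⋆ f) n
      ≈⟨ sumTo-suc n _ ⟩
    ι 1 * (1# * f n) + sumTo n (λ k → ι (n C suc k) * (0# * f (n ℕ.∸ suc k)))
      ≈⟨ +-congˡ (sumTo-zero n (λ k → trans (*-congˡ (zeroˡ _)) (zeroʳ _))) ⟩
    ι 1 * (1# * f n) + 0#
      ≈⟨ trans (+-identityʳ _) (trans (*-cong (+-identityʳ 1#) (*-identityˡ _)) (*-identityˡ _)) ⟩
    f n
      ∎
    where open ≈-Reasoning

  ⋆-identityʳ : ∀ f → f ⋆ 𝟙 ≋ f
  ⋆-identityʳ f = ≋-trans (⋆-comm f 𝟙) (⋆-identityˡ f)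

  ⋆-inverse-unique : ∀ {f g h} → g ⋆ f ≋ 𝟙 → f ⋆ h ≋ 𝟙 → g ≋ h
  ⋆-inverse-unique {f} {g} {h} gf≋𝟙 fh≋𝟙 = begin
    g            ≈⟨ ⋆-identityʳ g ⟨
    g ⋆ 𝟙        ≈⟨ ⋆-congˡ g fh≋𝟙 ⟨
    g ⋆ (f ⋆ h)  ≈⟨ ⋆-assoc g f h ⟨
    (g ⋆ f) ⋆ h  ≈⟨ ⋆-congʳ h gf≋𝟙 ⟩
    𝟙 ⋆ h        ≈⟨ ⋆-identityˡ h ⟩
    h            ∎
    where open ≋-Reasoning

  linearCombination : ℕ → (ℕ → Carrier) → (ℕ → Series) → Series
  linearCombination j a G n = sumTo j (λ l → a l * G l n)

  linearCombination-cong : ∀ j a {G H} → (∀ l → G l ≋ H l) →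
    linearCombination j a G ≋ linearCombination j a H
  linearCombination-cong j a G≋H n = sumTo-cong j (λ l → *-congˡ (G≋H l n))

  linearCombination-· : ∀ j a b G → linearCombination j a (λ l → b · G l) ≋ b · linearCombination j a G
  linearCombination-· j a b G n =
    trans (sumTo-cong j (λ l → x*[y*z]≈y*[x*z] _ _ _)) (sym (*-distribˡ-sumTo j b _))

  linearCombination-⋆ : ∀ j a G h → linearCombination j a G ⋆ h ≋ linearCombination j a (λ l → G l ⋆ h)
  linearCombination-⋆ zero a G h n = sumTo-zero (suc n) (λ k → trans (*-congˡ (zeroˡ _)) (zeroʳ _))
  linearCombination-⋆ (suc j) a G h n = trans (⋆-distribʳ-⊕ (linearCombination j a G) (a j · G j) h n)
    (+-cong (linearCombination-⋆ j a G h n) (·-⋆-assoc (a j) (G j) h n))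

  ⋆-linearCombination : ∀ j a G h → h ⋆ linearCombination j a G ≋ linearCombination j a (λ l → h ⋆ G l)
  ⋆-linearCombination j a G h = ≋-trans (⋆-comm h (linearCombination j a G))
    (≋-trans (linearCombination-⋆ j a G h) (linearCombination-cong j a (λ l → ⋆-comm (G l) h)))

  module _ (a : Carrier) (f : Series) where

    invTable-stable : ∀ {n i} → i ℕ.≤ n → invTable a f n i ≡ egfInv a f i
    invTable-stable {zero} {zero} ℕ.z≤n = ≡.refl
    invTable-stable {suc n} {i} i≤1+n with ℕ.m≤n⇒m<n∨m≡n i≤1+n
    ... | inj₂ ≡.refl = ≡.refl
    ... | inj₁ (ℕ.s≤s i≤n) with i ≤ᵇ n | ℕ.≤ᵇ-reflects-≤ i n
    ...   | true | _ = invTable-stable i≤n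
    ...   | false | ofⁿ i≰n = contradiction i≤n i≰n

    egfInv-suc : ∀ n → egfInv a f (suc n) ≈
      - (a * sumTo (suc n) (λ k → ι (suc n C suc k) * (f (suc k) * egfInv a f (n ℕ.∸ k))))
    egfInv-suc n with suc n ≤ᵇ n | ℕ.≤ᵇ-reflects-≤ (suc n) n
    ... | true | ofʸ 1+n≤n = contradiction 1+n≤n (ℕ.n≮n n)
    ... | false | _ = -‿cong (*-congˡ (sumTo-cong (suc n) (λ k →
      *-congˡ (*-congˡ (reflexive (invTable-stable (ℕ.m∸n≤m n k)))))))

    ⋆-egfInv : a * f 0 ≈ 1# → f ⋆ egfInv a f ≋ 𝟙
    ⋆-egfInv af₀≈1 zero = trans (⋆-at-0 f (egfInv a f)) (trans (*-comm _ _) af₀≈1)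
    ⋆-egfInv af₀≈1 (suc n) = begin
      (f ⋆ egfInv a f) (suc n)              ≈⟨ sumTo-suc (suc n) _ ⟩
      ι 1 * (f 0 * egfInv a f (suc n)) + S  ≈⟨ +-congʳ (*-congˡ (*-congˡ (egfInv-suc n))) ⟩
      ι 1 * (f 0 * - (a * S)) + S           ≈⟨ solve 3 (λ f₀ a S →
                                                 (con (+ 1) :+ con +0) :* (f₀ :* :- (a :* S)) :+ S
                                                   := S :* (con (+ 1) :- a :* f₀)) refl (f 0) a S ⟩
      S * (1# - a * f 0)                    ≈⟨ *-congˡ (+-congˡ (-‿cong af₀≈1)) ⟩
      S * (1# - 1#)                         ≈⟨ trans (*-congˡ (-‿inverseʳ 1#)) (zeroʳ S) ⟩
      0#                                    ∎
      where
      open ≈-Reasoning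
      S : Carrier
      S = sumTo (suc n) (λ k → ι (suc n C suc k) * (f (suc k) * egfInv a f (n ℕ.∸ k)))

  falling-cong : ∀ n {x y μ ν} → x ≈ y → μ ≈ ν → falling x μ n ≈ falling y ν n
  falling-cong zero x≈y μ≈ν = refl
  falling-cong (suc n) x≈y μ≈ν = *-cong (falling-cong n x≈y μ≈ν) (+-cong x≈y (-‿cong (*-congˡ μ≈ν)))

  falling-suc : ∀ n x μ → falling x μ (suc n) ≈ x * falling (x - μ) μ n
  falling-suc zero x μ = solve 2 (λ x μ → con (+ 1) :* (x :- con +0 :* μ) := x :* con (+ 1)) refl x μ
  falling-suc (suc n) x μ = begin
    falling x μ (suc n) * (x - (1# + ι n) * μ)        ≈⟨ *-congʳ (falling-suc n x μ) ⟩
    (x * falling (x - μ) μ n) * (x - (1# + ι n) * μ)  ≈⟨ solve 4 (λ x F i μ →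
                                                          (x :* F) :* (x :- (con (+ 1) :+ i) :* μ)
                                                            := x :* (F :* ((x :- μ) :- i :* μ)))
                                                          refl x _ (ι n) μ ⟩
    x * (falling (x - μ) μ n * ((x - μ) - ι n * μ))   ∎
    where open ≈-Reasoning

  ∂-degExp : ∀ μ x → ∂ (degExp μ x) ≋ x · degExp μ (x - μ)
  ∂-degExp μ x n = falling-suc n x μ

  degExp-+ : ∀ μ x y → degExp μ x ⋆ degExp μ y ≋ degExp μ (x + y)
  degExp-+ μ x y zero = trans (⋆-at-0 (degExp μ x) (degExp μ y)) (*-identityˡ 1#)
  degExp-+ μ x y (suc n) = begin
    (degExp μ x ⋆ degExp μ y) (suc n)
      ≈⟨ ∂-⋆ (degExp μ x) (degExp μ y) n ⟩
    (∂ (degExp μ x) ⋆ degExp μ y) n + (degExp μ x ⋆ ∂ (degExp μ y)) n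
      ≈⟨ +-cong (trans (⋆-congʳ (degExp μ y) (∂-degExp μ x) n)
                       (·-⋆-assoc x (degExp μ (x - μ)) (degExp μ y) n))
                (trans (⋆-congˡ (degExp μ x) (∂-degExp μ y) n)
                       (⋆-·-comm y (degExp μ x) (degExp μ (y - μ)) n)) ⟩
    x * (degExp μ (x - μ) ⋆ degExp μ y) n + y * (degExp μ x ⋆ degExp μ (y - μ)) n
      ≈⟨ +-cong (*-congˡ (degExp-+ μ (x - μ) y n)) (*-congˡ (degExp-+ μ x (y - μ) n)) ⟩
    x * falling ((x - μ) + y) μ n + y * falling (x + (y - μ)) μ n
      ≈⟨ +-cong (*-congˡ (falling-cong n (solve 3 (λ x y μ → (x :- μ) :+ y := (x :+ y) :- μ) refl x y μ) refl))
                (*-congˡ (falling-cong n (solve 3 (λ x y μ → x :+ (y :- μ) := (x :+ y) :- μ) refl x y μ) refl))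
      ⟩
    x * falling ((x + y) - μ) μ n + y * falling ((x + y) - μ) μ n
      ≈⟨ distribʳ _ _ _ ⟨
    (x + y) * falling ((x + y) - μ) μ n
      ≈⟨ falling-suc n (x + y) μ ⟨
    degExp μ (x + y) (suc n)
      ∎
    where open ≈-Reasoning

  degExp-0 : ∀ μ → degExp μ 0# ≋ 𝟙
  degExp-0 μ zero = refl
  degExp-0 μ (suc n) = trans (falling-suc n 0# μ) (zeroˡ _)

  degExpPlusOne≋degExp⊕𝟙 : ∀ μ → degExpPlusOne μ ≋ degExp μ 1# ⊕ 𝟙
  degExpPlusOne≋degExp⊕𝟙 μ zero = refl
  degExpPlusOne≋degExp⊕𝟙 μ (suc n) = sym (+-identityʳ _)

  degExp-⋆-degExpPlusOne : ∀ μ y → degExp μ y ⋆ degExpPlusOne μ ≋ degExp μ (1# + y) ⊕ degExp μ y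
  degExp-⋆-degExpPlusOne μ y = begin
    degExp μ y ⋆ degExpPlusOne μ
      ≈⟨ ⋆-congˡ (degExp μ y) (degExpPlusOne≋degExp⊕𝟙 μ) ⟩
    degExp μ y ⋆ (degExp μ 1# ⊕ 𝟙)
      ≈⟨ ⋆-distribˡ-⊕ (degExp μ y) (degExp μ 1#) 𝟙 ⟩
    degExp μ y ⋆ degExp μ 1# ⊕ degExp μ y ⋆ 𝟙
      ≈⟨ (λ n → +-cong (degExp-+ μ y 1# n) (⋆-identityʳ (degExp μ y) n)) ⟩
    degExp μ (y + 1#) ⊕ degExp μ y
      ≈⟨ (λ n → +-congʳ (falling-cong n (+-comm y 1#) refl)) ⟩
    degExp μ (1# + y) ⊕ degExp μ y
      ∎
    where open ≋-Reasoning

  dilate : Carrier → Series → Series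
  dilate a f n = pow a n * f n

  dilate-cong : ∀ a {f g} → f ≋ g → dilate a f ≋ dilate a g
  dilate-cong a f≋g n = *-congˡ (f≋g n)

  dilate-⊕ : ∀ a f g → dilate a (f ⊕ g) ≋ dilate a f ⊕ dilate a g
  dilate-⊕ a f g n = distribˡ _ _ _

  dilate-𝟙 : ∀ a → dilate a 𝟙 ≋ 𝟙
  dilate-𝟙 a zero = *-identityʳ 1#
  dilate-𝟙 a (suc n) = zeroʳ _

  dilate-⋆ : ∀ a f g → dilate a (f ⋆ g) ≋ dilate a f ⋆ dilate a g
  dilate-⋆ a f g n = trans (*-distribˡ-sumTo (suc n) (pow a n) _) (sumTo-cong< (suc n) λ k k<1+n →
    trans (*-congʳ (pow-+-∸ a (ℕ.≤-pred k<1+n)))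
          (solve 5 (λ p q b x y → (p :* q) :* (b :* (x :* y)) := b :* ((p :* x) :* (q :* y))) refl _ _ _ _ _))

  dilate-twoTPow : ∀ a r → dilate a (twoTPow r) ≋ pow a r · twoTPow r
  dilate-twoTPow a r n with n ≡ᵇ r | fromEquivalence (ℕ.≡ᵇ⇒≡ n r) (ℕ.≡⇒≡ᵇ n r)
  ... | true | ofʸ ≡.refl = refl
  ... | false | _ = trans (zeroʳ _) (sym (zeroʳ _))

  -- Each factor yb - iμb of the falling factorial absorbs one factor a.
  dilate-degExp : ∀ {a b} → a * b ≈ 1# → ∀ μ y → dilate a (degExp (μ * b) (y * b)) ≋ degExp μ y
  dilate-degExp ab≈1 μ y zero = *-identityˡ 1#
  dilate-degExp {a} {b} ab≈1 μ y (suc n) = begin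
    (a * pow a n) * (falling (y * b) (μ * b) n * (y * b - ι n * (μ * b)))
      ≈⟨ solve 7 (λ a p F y b i μ → (a :* p) :* (F :* (y :* b :- i :* (μ :* b)))
                                      := (p :* F) :* ((a :* b) :* (y :- i :* μ)))
           refl a _ _ y b (ι n) μ ⟩
    (pow a n * falling (y * b) (μ * b) n) * ((a * b) * (y - ι n * μ))
      ≈⟨ *-cong (dilate-degExp ab≈1 μ y n) (trans (*-congʳ ab≈1) (*-identityˡ _)) ⟩
    falling y μ n * (y - ι n * μ)
      ∎
    where open ≈-Reasoning

  dilate-linearCombination : ∀ a j b G →
    dilate a (linearCombination j b G) ≋ linearCombination j b (λ l → dilate a (G l))
  dilate-linearCombination a j b G n =
    trans (*-distribˡ-sumTo j (pow a n) _) (sumTo-cong j (λ l → x*[y*z]≈y*[x*z] _ _ _))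

  module MultiplicationFormula (half : Carrier) (half-inverse : (1# + 1#) * half ≈ 1#) (r : ℕ) where

    reciprocal : Carrier → Series
    reciprocal μ = egfInv half (degExpPlusOne μ)

    eulerGenocchi : Carrier → Carrier → Series
    eulerGenocchi μ x n = A half n μ r x

    reciprocal-⋆-degExpPlusOne : ∀ μ → reciprocal μ ⋆ degExpPlusOne μ ≋ 𝟙
    reciprocal-⋆-degExpPlusOne μ = ≋-trans (⋆-comm (reciprocal μ) (degExpPlusOne μ))
      (⋆-egfInv half (degExpPlusOne μ) (trans (*-comm half _) half-inverse))

    module _ (μ : Carrier) (k : ℕ) (m⁻¹ : Carrier) (m*m⁻¹≈1 : ι (suc (2 ℕ.* k)) * m⁻¹ ≈ 1#) where

      m : ℕ
      m = suc (2 ℕ.* k)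

      μ/m : Carrier
      μ/m = μ * m⁻¹

      alternatingDegExp : Series
      alternatingDegExp = linearCombination m (pow (- 1#)) (λ l → degExp μ (ι l))

      alternatingDegExp-⋆-degExpPlusOne : alternatingDegExp ⋆ degExpPlusOne μ ≋ degExp μ (ι m) ⊕ 𝟙
      alternatingDegExp-⋆-degExpPlusOne n = begin
        (alternatingDegExp ⋆ degExpPlusOne μ) n
          ≈⟨ linearCombination-⋆ m (pow (- 1#)) (λ l → degExp μ (ι l)) (degExpPlusOne μ) n ⟩
        sumTo m (λ l → pow (- 1#) l * (degExp μ (ι l) ⋆ degExpPlusOne μ) n)
          ≈⟨ sumTo-cong m (λ l → *-congˡ (degExp-⋆-degExpPlusOne μ (ι l) n)) ⟩
        sumTo m (λ l → pow (- 1#) l * (degExp μ (ι (suc l)) n + degExp μ (ι l) n))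
          ≈⟨ alternatingSum-telescopes m (λ l → degExp μ (ι l) n) ⟩
        degExp μ 0# n - pow (- 1#) m * degExp μ (ι m) n
          ≈⟨ +-cong (degExp-0 μ n) (-‿cong (*-congʳ (pow-odd k))) ⟩
        𝟙 n - - 1# * degExp μ (ι m) n
          ≈⟨ solve 2 (λ u e → u :- :- con (+ 1) :* e := e :+ u) refl (𝟙 n) _ ⟩
        degExp μ (ι m) n + 𝟙 n
          ∎
        where open ≈-Reasoning

      dilate-degExpPlusOne : dilate (ι m) (degExpPlusOne μ/m) ≋ degExp μ (ι m) ⊕ 𝟙
      dilate-degExpPlusOne = begin
        dilate (ι m) (degExpPlusOne μ/m)
          ≈⟨ dilate-cong (ι m) (degExpPlusOne≋degExp⊕𝟙 μ/m) ⟩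
        dilate (ι m) (degExp μ/m 1# ⊕ 𝟙)
          ≈⟨ dilate-⊕ (ι m) (degExp μ/m 1#) 𝟙 ⟩
        dilate (ι m) (degExp μ/m 1#) ⊕ dilate (ι m) 𝟙
          ≈⟨ (λ n → +-congʳ (*-congˡ (falling-cong n (sym m*m⁻¹≈1) refl))) ⟩
        dilate (ι m) (degExp μ/m (ι m * m⁻¹)) ⊕ dilate (ι m) 𝟙
          ≈⟨ (λ n → +-cong (dilate-degExp m*m⁻¹≈1 μ (ι m) n) (dilate-𝟙 (ι m) n)) ⟩
        degExp μ (ι m) ⊕ 𝟙
          ∎
        where open ≋-Reasoning

      -- Both sides are inverses of e_μ(t) + 1.
      dilate-reciprocal-⋆-alternatingDegExp : dilate (ι m) (reciprocal μ/m) ⋆ alternatingDegExp ≋ reciprocal μ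
      dilate-reciprocal-⋆-alternatingDegExp = ⋆-inverse-unique left-inverse
        (≋-trans (⋆-comm (degExpPlusOne μ) (reciprocal μ)) (reciprocal-⋆-degExpPlusOne μ))
        where
        open ≋-Reasoning
        J : Series
        J = dilate (ι m) (reciprocal μ/m)
        left-inverse : (J ⋆ alternatingDegExp) ⋆ degExpPlusOne μ ≋ 𝟙
        left-inverse = begin
          (J ⋆ alternatingDegExp) ⋆ degExpPlusOne μ
            ≈⟨ ⋆-assoc J alternatingDegExp (degExpPlusOne μ) ⟩
          J ⋆ (alternatingDegExp ⋆ degExpPlusOne μ)
            ≈⟨ ⋆-congˡ J (≋-trans alternatingDegExp-⋆-degExpPlusOne (≋-sym dilate-degExpPlusOne)) ⟩
          J ⋆ dilate (ι m) (degExpPlusOne μ/m)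
            ≈⟨ dilate-⋆ (ι m) (reciprocal μ/m) (degExpPlusOne μ/m) ⟨
          dilate (ι m) (reciprocal μ/m ⋆ degExpPlusOne μ/m)
            ≈⟨ dilate-cong (ι m) (reciprocal-⋆-degExpPlusOne μ/m) ⟩
          dilate (ι m) 𝟙
            ≈⟨ dilate-𝟙 (ι m) ⟩
          𝟙
            ∎

      dilate-eulerGenocchi : ∀ y → dilate (ι m) (eulerGenocchi μ/m (y * m⁻¹)) ≋
        pow (ι m) r · ((twoTPow r ⋆ dilate (ι m) (reciprocal μ/m)) ⋆ degExp μ y)
      dilate-eulerGenocchi y = begin
        dilate (ι m) ((T ⋆ reciprocal μ/m) ⋆ degExp μ/m (y * m⁻¹))
          ≈⟨ dilate-⋆ (ι m) (T ⋆ reciprocal μ/m) (degExp μ/m (y * m⁻¹)) ⟩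
        dilate (ι m) (T ⋆ reciprocal μ/m) ⋆ dilate (ι m) (degExp μ/m (y * m⁻¹))
          ≈⟨ ⋆-cong (dilate-⋆ (ι m) T (reciprocal μ/m)) (dilate-degExp m*m⁻¹≈1 μ y) ⟩
        (dilate (ι m) T ⋆ J) ⋆ degExp μ y
          ≈⟨ ⋆-congʳ (degExp μ y) (≋-trans (⋆-congʳ J (dilate-twoTPow (ι m) r))
                                            (·-⋆-assoc (pow (ι m) r) T J)) ⟩
        (pow (ι m) r · (T ⋆ J)) ⋆ degExp μ y
          ≈⟨ ·-⋆-assoc (pow (ι m) r) (T ⋆ J) (degExp μ y) ⟩
        pow (ι m) r · ((T ⋆ J) ⋆ degExp μ y)
          ∎
        where
        open ≋-Reasoning
        T J : Series
        T = twoTPow r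
        J = dilate (ι m) (reciprocal μ/m)

      alternatingEulerGenocchi : Carrier → Series
      alternatingEulerGenocchi x =
        linearCombination m (pow (- 1#)) (λ l → eulerGenocchi μ/m ((ι l + x) * m⁻¹))

      dilate-alternatingEulerGenocchi : ∀ x →
        dilate (ι m) (alternatingEulerGenocchi x) ≋ pow (ι m) r · eulerGenocchi μ x
      dilate-alternatingEulerGenocchi x = begin
        dilate (ι m) (alternatingEulerGenocchi x)
          ≈⟨ dilate-linearCombination (ι m) m (pow (- 1#)) _ ⟩
        linearCombination m (pow (- 1#)) (λ l → dilate (ι m) (eulerGenocchi μ/m ((ι l + x) * m⁻¹)))
          ≈⟨ linearCombination-cong m (pow (- 1#)) (λ l → dilate-eulerGenocchi (ι l + x)) ⟩
        linearCombination m (pow (- 1#)) (λ l → pow (ι m) r · (T ⋆ J) ⋆ degExp μ (ι l + x))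
          ≈⟨ linearCombination-· m (pow (- 1#)) (pow (ι m) r) _ ⟩
        pow (ι m) r · linearCombination m (pow (- 1#)) (λ l → (T ⋆ J) ⋆ degExp μ (ι l + x))
          ≈⟨ ·-congˡ (pow (ι m) r) (linearCombination-cong m (pow (- 1#))
               (λ l → ⋆-congˡ (T ⋆ J) (≋-sym (degExp-+ μ (ι l) x)))) ⟩
        pow (ι m) r · linearCombination m (pow (- 1#)) (λ l → (T ⋆ J) ⋆ (degExp μ (ι l) ⋆ degExp μ x))
          ≈⟨ ·-congˡ (pow (ι m) r) (≋-sym (≋-trans
               (⋆-congˡ (T ⋆ J) (linearCombination-⋆ m (pow (- 1#)) (λ l → degExp μ (ι l)) (degExp μ x)))
               (⋆-linearCombination m (pow (- 1#)) (λ l → degExp μ (ι l) ⋆ degExp μ x) (T ⋆ J)))) ⟩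
        pow (ι m) r · ((T ⋆ J) ⋆ (alternatingDegExp ⋆ degExp μ x))
          ≈⟨ ·-congˡ (pow (ι m) r) (≋-trans (⋆-assoc T J (alternatingDegExp ⋆ degExp μ x))
               (⋆-congˡ T (≋-sym (⋆-assoc J alternatingDegExp (degExp μ x))))) ⟩
        pow (ι m) r · (T ⋆ ((J ⋆ alternatingDegExp) ⋆ degExp μ x))
          ≈⟨ ·-congˡ (pow (ι m) r) (≋-trans
               (⋆-congˡ T (⋆-congʳ (degExp μ x) dilate-reciprocal-⋆-alternatingDegExp))
               (≋-sym (⋆-assoc T (reciprocal μ) (degExp μ x)))) ⟩
        pow (ι m) r · eulerGenocchi μ x
          ∎
        where
        open ≋-Reasoning
        T J : Series
        T = twoTPow r
        J = dilate (ι m) (reciprocal μ/m)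

theorem2 : ∀ {c ℓ : Level} (R : CommutativeRing c ℓ) →
    let open Ops R in
    (half : Carrier) → (1# + 1#) * half ≈ 1# →
    (lam : Carrier) → ¬ (lam ≈ 0#) →
    (r : ℕ) → (m k : ℕ) → m ≡ suc (2 ℕ.* k) →
    (minv : Carrier) → ι m * minv ≈ 1# →
    (x : Carrier) → (n : ℕ) →
    A half n lam r x ≈
      mPowDiff m minv n r *
        sumTo m (λ l → pow (- 1#) l * A half n (lam * minv) r ((ι l + x) * minv))
theorem2 R half half-inverse μ _ r m k ≡.refl m⁻¹ m*m⁻¹≈1 x n =
  mPowDiff-cancel R {m} {m⁻¹} m*m⁻¹≈1 n r (dilate-alternatingEulerGenocchi μ k m⁻¹ m*m⁻¹≈1 x n)
  where open MultiplicationFormula R half half-inverse r using (dilate-alternatingEulerGenocchi)
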